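{- Let $\mathbf A=\bigotimes_{i=1}^k\mathbf L_i$ be a wreath product representation of a nilpotent Maltsev algebra $\mathbf A$ such that $\exp(\mathbf L_i)=p$ for every $i$, for a fixed prime $p$. Let $m$ be a Maltsev polynomial, $0\in A$ the element identified with the all-zero tuple, and $x+y:=m(x,0,y)$. For every prime $q$ define the unary polynomials $u_q(x)=q\cdot x=x+\dots+x$ ($q$ summands, associated to the left) and $u_{q^{l+1}}(x)=u_q(u_{q^l}(x))$ for $l\ge1$. Then: (1) if $q\neq p$, then $u_{q^l}$ is a bijection of $A$ for every $l\ge1$; (2) $u_{p^l}(x)=0$ for all $x\in A$ and all $l\ge k$.
   Context: Polynomial operations of $\mathbf A$ are compositions of basic operations, projections and constants; $\mathbf A$ is Maltsev if it has a polynomial $m$ with $m(y,x,x)=m(x,x,y)=y$. An algebra is affine if polynomially equivalent to a module; $\exp(\mathbf L)$ is the exponent of $(L,+)$. A wreath product representation $\mathbf A=\bigotimes_{i=1}^k\mathbf L_i$ consists of affine algebras $\mathbf L_1,\dots,\mathbf L_k$ of the signature of $\mathbf A$ and an identification of $A$ with $L_1\times\dots\times L_k$ such that for each basic operation $f$ (applied coordinatewise to tuples $\bar x$), $\pi_{L_i}(f(\bar x))=f^{\mathbf L_i}(\pi_{L_i}(\bar x))+\hat f_i(\pi_{L_{i+1}\times\dots\times L_k}(\bar x))$ for some function $\hat f_i$ (with $\hat f_k$ constant), where $+$ is the module addition of $\mathbf L_i$; the kernels of the projections onto $L_{i+1}\times\dots\times L_k$ form a chain $\mathbf 0_A=\alpha_0<\dots<\alpha_k=\mathbf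 1_A$ with $[\mathbf 1_A,\alpha_i]\le\alpha_{i-1}$ (binary commutator). -}

module Defs where

open import Level using (0ℓ) renaming (suc to lsuc)
open import Data.Nat using (ℕ; zero; suc; _<_; _≤_)
open import Data.Fin using (Fin; zero; suc; toℕ; inject₁; fromℕ)
open import Data.Sum using (_⊎_; inj₁; inj₂; [_,_])
open import Data.Product using (Σ; ∃; _×_; _,_; proj₁; proj₂)
open import Data.Unit using (⊤; tt)
open import Data.Empty using (⊥)
open import Function using (_∘_; id; _↔_; Inverse)
open import Relation.Nullary using (¬_)
open import Relation.Binary.PropositionalEquality using (_≡_; _≢_)
open import Relation.Binary.Structures using (IsEquivalence)
open import Algebra.Bundles using (Ring)
open import Algebra.Module.Structures using (IsLeftModule)

record Signature : Set₁ where
  field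
    Op    : Set
    arity : Op → ℕ
open Signature public

record Algebra (S : Signature) : Set₁ where
  field
    Carrier : Set
    ⟦_⟧     : (f : Op S) → (Fin (arity S f) → Carrier) → Carrier
open Algebra public

data Term (S : Signature) (X : Set) : Set where
  var : X → Term S X
  op  : (f : Op S) → (Fin (arity S f) → Term S X) → Term S X

eval : ∀ {S X} (A : Algebra S) → (X → Carrier A) → Term S X → Carrier A
eval A ρ (var x)   = ρ x
eval A ρ (op f ts) = ⟦ A ⟧ f (λ j → eval A ρ (ts j))

-- n-ary polynomials of A: terms over the variables Fin n and constants from A
Poly : ∀ {S} (A : Algebra S) (n : ℕ) → Set
Poly {S} A n = Term S (Fin n ⊎ Carrier A)

evalP : ∀ {S} (A : Algebra S) {n : ℕ} → Poly A n → (Fin n → Carrier A) → Carrier A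
evalP A t xs = eval A [ xs , id ] t

IsPolyOp : ∀ {S} (A : Algebra S) (n : ℕ) → ((Fin n → Carrier A) → Carrier A) → Set
IsPolyOp A n f = Σ (Poly A n) λ t → ∀ xs → evalP A t xs ≡ f xs

IsMaltsev : ∀ {S} (A : Algebra S) → Poly A 3 → Set
IsMaltsev A m =
  ∀ x y → (evalP A m (λ { zero → y ; (suc zero) → x ; (suc (suc zero)) → x }) ≡ y)
        × (evalP A m (λ { zero → x ; (suc zero) → x ; (suc (suc zero)) → y }) ≡ y)

record ModuleOn (X : Set) : Set₁ where
  field
    ring : Ring 0ℓ 0ℓ
    _+ᴹ_ : X → X → X
    0ᴹ   : X
    -ᴹ_  : X → X
    _*ₗ_ : Ring.Carrier ring → X → X
    isLeftModule : IsLeftModule ring _≡_ _+ᴹ_ 0ᴹ -ᴹ_ _*ₗ_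

data ModOp (R : Set) : Set where
  addM zeroM negM : ModOp R
  scalM : R → ModOp R

ModSig : Set → Signature
ModSig R = record
  { Op = ModOp R
  ; arity = λ { addM → 2 ; zeroM → 0 ; negM → 1 ; (scalM _) → 1 } }

moduleAlgebra : ∀ {X} (M : ModuleOn X) → Algebra (ModSig (Ring.Carrier (ModuleOn.ring M)))
moduleAlgebra {X} M = record { Carrier = X ; ⟦_⟧ = interp }
  where
  open ModuleOn M
  interp : (f : ModOp (Ring.Carrier ring)) → (Fin (arity (ModSig (Ring.Carrier ring)) f) → X) → X
  interp addM xs      = xs zero +ᴹ xs (suc zero)
  interp zeroM xs     = 0ᴹ
  interp negM xs      = -ᴹ xs zero
  interp (scalM r) xs = r *ₗ xs zero

mulM : ∀ {X} (M : ModuleOn X) → ℕ → X → X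
mulM M zero x    = ModuleOn.0ᴹ M
mulM M (suc n) x = ModuleOn._+ᴹ_ M x (mulM M n x)

HasExponent : ∀ {X} (M : ModuleOn X) → ℕ → Set
HasExponent M e =
  (0 < e) × (∀ x → mulM M e x ≡ ModuleOn.0ᴹ M)
  × (∀ n → 0 < n → n < e → ∃ λ x → mulM M n x ≢ ModuleOn.0ᴹ M)

record AffineStructure {S} (L : Algebra S) : Set₁ where
  field
    modl   : ModuleOn (Carrier L)
    polyEq : ∀ (n : ℕ) (f : (Fin n → Carrier L) → Carrier L) →
               (IsPolyOp L n f → IsPolyOp (moduleAlgebra modl) n f)
             × (IsPolyOp (moduleAlgebra modl) n f → IsPolyOp L n f)

BinRel : Set → Set₁
BinRel X = X → X → Set

record IsCongruence {S} (A : Algebra S) (θ : BinRel (Carrier A)) : Set where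
  field
    isEquivalence : IsEquivalence θ
    compatible    : ∀ f (xs ys : Fin (arity S f) → Carrier A) →
                    (∀ j → θ (xs j) (ys j)) → θ (⟦ A ⟧ f xs) (⟦ A ⟧ f ys)

-- term condition C(α, β; δ); for congruences, [α, β] ≤ δ  iff  C(α, β; δ)
-- (the commutator [α, β] being the least congruence δ with C(α, β; δ))
TC : ∀ {S} (A : Algebra S) (α β δ : BinRel (Carrier A)) → Set
TC {S} A α β δ =
  ∀ (n m : ℕ) (t : Term S (Fin n ⊎ Fin m)) (a b : Fin n → Carrier A) (c d : Fin m → Carrier A) →
    (∀ i → α (a i) (b i)) → (∀ j → β (c j) (d j)) →
    δ (eval A [ a , c ] t) (eval A [ a , d ] t) →
    δ (eval A [ b , c ] t) (eval A [ b , d ] t)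

total : ∀ {X : Set} → BinRel X
total _ _ = ⊤

Nilpotent : ∀ {S} (A : Algebra S) → Set₁
Nilpotent A = Σ ℕ λ n → Σ (Fin (suc n) → BinRel (Carrier A)) λ β →
    (∀ i → IsCongruence A (β i))
  × (∀ x y → (β zero x y → x ≡ y) × (x ≡ y → β zero x y))
  × (∀ x y → β (fromℕ n) x y)
  × (∀ (i : Fin n) x y → β (inject₁ i) x y → β (suc i) x y)
  × (∀ (i : Fin n) → TC A total (β (suc i)) (β (inject₁ i)))

-- L_1 × ... × L_k as an iterated product (coordinate i ↔ Fin index i, 0-based)
Prod : (k : ℕ) → (Fin k → Set) → Set
Prod zero    L = ⊤
Prod (suc k) L = L zero × Prod k (L ∘ suc)

coord : ∀ {k} {L : Fin k → Set} → Prod k L → (i : Fin k) → L i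
coord {suc k} (x , xs) zero    = x
coord {suc k} (x , xs) (suc i) = coord xs i

tabulateP : ∀ {k} {L : Fin k → Set} → ((i : Fin k) → L i) → Prod k L
tabulateP {zero}  z = tt
tabulateP {suc k} z = z zero , tabulateP (z ∘ suc)

record WreathRep {S} (A : Algebra S) (k : ℕ) : Set₁ where
  field
    L       : Fin k → Algebra S
    affine  : (i : Fin k) → AffineStructure (L i)
  Univ : Fin k → Set
  Univ i = Carrier (L i)
  _+ᵢ_ : ∀ {i} → Univ i → Univ i → Univ i
  _+ᵢ_ {i} = ModuleOn._+ᴹ_ (AffineStructure.modl (affine i))
  field
    φ       : Carrier A ↔ Prod k Univ
  π : Carrier A → (i : Fin k) → Univ i
  π x = coord (Inverse.to φ x)
  -- kernel α_i of the projection onto L_{i+1} × ... × L_k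
  -- (1-based; i.e. the 0-based coordinates j with i ≤ j)
  α : ℕ → BinRel (Carrier A)
  α i x y = ∀ (j : Fin k) → i ≤ toℕ j → π x j ≡ π y j
  field
    wreath  : ∀ (i : Fin k) (f : Op S) →
      Σ ((Fin (arity S f) → Carrier A) → Univ i) λ fhat →
        (∀ xs ys → (∀ r (j : Fin k) → toℕ i < toℕ j → π (xs r) j ≡ π (ys r) j) →
           fhat xs ≡ fhat ys)
        × (∀ xs → π (⟦ A ⟧ f xs) i ≡ (⟦ L i ⟧ f (λ r → π (xs r) i) +ᵢ fhat xs))
    central : ∀ (i : Fin k) → TC A total (α (suc (toℕ i))) (α (toℕ i))
  zeroA : Carrier A
  zeroA = Inverse.from φ (tabulateP (λ i → ModuleOn.0ᴹ (AffineStructure.modl (affine i))))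

mulL : ∀ {X : Set} → (X → X → X) → ℕ → X → X
mulL _+_ zero          x = x      -- unused (only q ≥ 2 prime is used)
mulL _+_ (suc zero)    x = x
mulL _+_ (suc (suc n)) x = mulL _+_ (suc n) x + x

uPow : ∀ {X : Set} → (X → X → X) → ℕ → ℕ → X → X
uPow _+_ q zero    x = x
uPow _+_ q (suc l) x = mulL _+_ q (uPow _+_ q l x)

plusVia : ∀ {S} (A : Algebra S) → Poly A 3 → Carrier A → Carrier A → Carrier A → Carrier A
plusVia A m z x y = evalP A m (λ { zero → x ; (suc zero) → z ; (suc (suc zero)) → y })

{-# OPTIONS --safe #-}
module Submission where

-- Every basic operation of A acts on coordinate i of the wreath product as the corresponding
-- operation of L_i plus a correction depending only on the later coordinates, and L_i is
-- polynomially a module. By induction, every polynomial acts on coordinate i as an affine map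
-- of the i-th coordinates of its arguments plus a carry from the later coordinates. For the
-- Maltsev sum this reads π_i(x + y) = π_i x + π_i y + c(x, y), so u_q acts on coordinate i as
-- a ↦ q·a + (carry): it is triangular. If q is prime to p, then a ↦ q·a is invertible on
-- every L_i (Bézout), so u_q is bijective. If q = p, then q·a = 0, so u_p turns an element that
-- vanishes beyond coordinate i into one that vanishes from coordinate i on; after k steps
-- nothing is left.

open import Defs
open import Level using (0ℓ)
open import Data.Empty using (⊥-elim)
open import Data.Fin using (Fin; zero; suc; toℕ)
open import Data.Fin.Properties using (toℕ<n)
open import Data.Nat as ℕ using (ℕ; zero; suc; NonZero; _<_; _≤_; s≤s; z≤n)
open import Data.Nat.Properties using (<-cmp; ≤-trans; <⇒≤; <⇒≱; +-suc; +-monoˡ-≤; +-identityʳ; m≤n+m; *-comm)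
open import Data.Nat.GCD using (module Bézout)
open import Data.Nat.Coprimality as Coprimality using (Coprime; coprime-Bézout; prime⇒coprime)
open import Data.Nat.Primality using (Prime; prime⇒nonZero)
open import Data.Product using (Σ; _×_; _,_; proj₁; proj₂)
open import Data.Sum using (inj₁; inj₂)
open import Function using (_∘_; _↔_; Inverse)
open import Function.Definitions using (Injective; StrictlySurjective; Bijective)
open import Function.Consequences.Propositional using (strictlySurjective⇒surjective)
import Function.Construct.Composition as Composition
import Function.Construct.Identity as Identity
open import Algebra.Bundles using (AbelianGroup; Ring)
open import Algebra.Module.Bundles using (LeftModule)
open import Relation.Binary.Definitions using (tri<; tri≈; tri>)
open import Relation.Binary.PropositionalEquality
  using (_≡_; _≢_; refl; sym; trans; cong; cong₂; subst; module ≡-Reasoning)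
open ≡-Reasoning

module ModuleOnProperties {X : Set} (M : ModuleOn X) where
  open ModuleOn M public using (ring; _*ₗ_; 0ᴹ) renaming (_+ᴹ_ to infixl 6 _+_; -ᴹ_ to infix 8 -_)

  private
    leftModule : LeftModule ring 0ℓ 0ℓ
    leftModule = record { isLeftModule = ModuleOn.isLeftModule M }

  open LeftModule leftModule using (+ᴹ-abelianGroup; *ₗ-distribˡ; *ₗ-zeroʳ)
  open AbelianGroup +ᴹ-abelianGroup public using (assoc; comm; identityˡ; identityʳ; inverseʳ)
  open import Algebra.Properties.AbelianGroup +ᴹ-abelianGroup
    using (inverseˡ-unique; inverseʳ-unique; ε⁻¹≈ε; ⁻¹-involutive; ⁻¹-∙-comm; //-rightDividesˡ; quasigroup)
  open import Algebra.Properties.Quasigroup quasigroup public using (cancelʳ; x≈z//y)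
  open import Algebra.Properties.CommutativeSemigroup (AbelianGroup.commutativeSemigroup +ᴹ-abelianGroup)
    public using (interchange)

  d : X → X → X → X
  d x y z = x + - y + z

  d-cancelʳ : ∀ x y → d x y y ≡ x
  d-cancelʳ x y = //-rightDividesˡ y x

  d-cancelˡ : ∀ x y → d x x y ≡ y
  d-cancelˡ x y = trans (cong (_+ y) (inverseʳ x)) (identityˡ y)

  d-zero : ∀ x y → d x 0ᴹ y ≡ x + y
  d-zero x y = trans (cong (λ z → x + z + y) ε⁻¹≈ε) (cong (_+ y) (identityʳ x))

  +-d : ∀ x y z x′ y′ z′ → d x y z + d x′ y′ z′ ≡ d (x + x′) (y + y′) (z + z′)
  +-d x y z x′ y′ z′ = begin
    (x + - y + z) + (x′ + - y′ + z′)      ≡⟨ interchange _ z _ z′ ⟩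
    (x + - y + (x′ + - y′)) + (z + z′)    ≡⟨ cong (_+ (z + z′)) (interchange x (- y) x′ (- y′)) ⟩
    (x + x′ + (- y + - y′)) + (z + z′)    ≡⟨ cong (λ w → x + x′ + w + (z + z′)) (⁻¹-∙-comm y y′) ⟩
    (x + x′ + - (y + y′)) + (z + z′)      ∎

  -‿d : ∀ x y z → - d x y z ≡ d (- x) (- y) (- z)
  -‿d x y z = trans (sym (⁻¹-∙-comm (x + - y) z)) (cong (_+ - z) (sym (⁻¹-∙-comm x (- y))))

  *ₗ-- : ∀ r x → r *ₗ (- x) ≡ - (r *ₗ x)
  *ₗ-- r x = inverseʳ-unique (r *ₗ x) (r *ₗ (- x))
    (trans (sym (*ₗ-distribˡ r x (- x))) (trans (cong (r *ₗ_) (inverseʳ x)) (*ₗ-zeroʳ r)))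

  *ₗ-d : ∀ r x y z → r *ₗ d x y z ≡ d (r *ₗ x) (r *ₗ y) (r *ₗ z)
  *ₗ-d r x y z = begin
    r *ₗ (x + - y + z)               ≡⟨ *ₗ-distribˡ r (x + - y) z ⟩
    r *ₗ (x + - y) + r *ₗ z          ≡⟨ cong (_+ r *ₗ z) (*ₗ-distribˡ r x (- y)) ⟩
    r *ₗ x + r *ₗ (- y) + r *ₗ z     ≡⟨ cong (λ w → r *ₗ x + w + r *ₗ z) (*ₗ-- r y) ⟩
    r *ₗ x + - (r *ₗ y) + r *ₗ z     ∎

  infixr 8 _·_
  _·_ : ℕ → X → X
  _·_ = mulM M

  ·-homo-+ : ∀ m n a → (m ℕ.+ n) · a ≡ m · a + n · a
  ·-homo-+ zero    n a = sym (identityˡ (n · a))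
  ·-homo-+ (suc m) n a = trans (cong (a +_) (·-homo-+ m n a)) (sym (assoc a (m · a) (n · a)))

  ·-assoc : ∀ m n a → (m ℕ.* n) · a ≡ m · n · a
  ·-assoc zero    n a = refl
  ·-assoc (suc m) n a = trans (·-homo-+ n (m ℕ.* n) a) (cong (n · a +_) (·-assoc m n a))

  ·-zeroʳ : ∀ n → n · 0ᴹ ≡ 0ᴹ
  ·-zeroʳ zero    = refl
  ·-zeroʳ (suc n) = trans (cong (0ᴹ +_) (·-zeroʳ n)) (identityˡ 0ᴹ)

  ·-homo-- : ∀ n a → n · (- a) ≡ - (n · a)
  ·-homo-- zero    a = sym ε⁻¹≈ε
  ·-homo-- (suc n) a = trans (cong (- a +_) (·-homo-- n a)) (⁻¹-∙-comm a (n · a))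

  module _ {p : ℕ} (p·≡0 : ∀ a → p · a ≡ 0ᴹ) where

    private
      ·-annihilated : ∀ y a → (y ℕ.* p) · a ≡ 0ᴹ
      ·-annihilated y a = trans (·-assoc y p a) (trans (cong (y ·_) (p·≡0 a)) (·-zeroʳ y))

    ·-invertible : ∀ {q} → Bézout.Identity 1 q p →
                   Σ (X → X) λ g → (∀ a → g (q · a) ≡ a) × (∀ a → q · g a ≡ a)
    ·-invertible {q} (Bézout.+- x y 1+yp≡xq) = (x ·_) , left , right
      where
      xq·≡id : ∀ a → (x ℕ.* q) · a ≡ a
      xq·≡id a = begin
        (x ℕ.* q) · a        ≡⟨ cong (_· a) 1+yp≡xq ⟨
        a + (y ℕ.* p) · a    ≡⟨ cong (a +_) (·-annihilated y a) ⟩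
        a + 0ᴹ               ≡⟨ identityʳ a ⟩
        a                    ∎
      left : ∀ a → x · q · a ≡ a
      left a = trans (sym (·-assoc x q a)) (xq·≡id a)
      right : ∀ a → q · x · a ≡ a
      right a = trans (sym (·-assoc q x a)) (trans (cong (_· a) (*-comm q x)) (xq·≡id a))
    ·-invertible {q} (Bézout.-+ x y 1+xq≡yp) = (λ a → - (x · a)) , left , right
      where
      xq·≡neg : ∀ a → (x ℕ.* q) · a ≡ - a
      xq·≡neg a = inverseˡ-unique _ a (begin
        (x ℕ.* q) · a + a   ≡⟨ comm _ a ⟩
        (1 ℕ.+ x ℕ.* q) · a ≡⟨ cong (_· a) 1+xq≡yp ⟩
        (y ℕ.* p) · a       ≡⟨ ·-annihilated y a ⟩
        0ᴹ                  ∎)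
      left : ∀ a → - (x · q · a) ≡ a
      left a = trans (cong -_ (trans (sym (·-assoc x q a)) (xq·≡neg a))) (⁻¹-involutive a)
      right : ∀ a → q · - (x · a) ≡ a
      right a = begin
        q · - (x · a)        ≡⟨ ·-homo-- q (x · a) ⟩
        - (q · x · a)        ≡⟨ cong -_ (·-assoc q x a) ⟨
        - ((q ℕ.* x) · a)    ≡⟨ cong (λ n → - (n · a)) (*-comm q x) ⟩
        - ((x ℕ.* q) · a)    ≡⟨ cong -_ (xq·≡neg a) ⟩
        - - a                ≡⟨ ⁻¹-involutive a ⟩
        a                    ∎

    module _ {q : ℕ} (q⊥p : Coprime q p) (c : X) where

      private
        inverse = ·-invertible (coprime-Bézout q⊥p)
        g = proj₁ inverse

      ·+-injective : Injective _≡_ _≡_ (λ a → q · a + c)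
      ·+-injective {a} {b} qa+c≡qb+c = begin
        a           ≡⟨ proj₁ (proj₂ inverse) a ⟨
        g (q · a)   ≡⟨ cong g (cancelʳ c (q · a) (q · b) qa+c≡qb+c) ⟩
        g (q · b)   ≡⟨ proj₁ (proj₂ inverse) b ⟩
        b           ∎

      ·+-strictlySurjective : StrictlySurjective _≡_ (λ a → q · a + c)
      ·+-strictlySurjective b = g (b + - c) , (begin
        q · g (b + - c) + c   ≡⟨ cong (_+ c) (proj₂ (proj₂ inverse) (b + - c)) ⟩
        b + - c + c           ≡⟨ //-rightDividesˡ c b ⟩
        b                     ∎)

  Mod : Algebra (ModSig (Ring.Carrier ring))
  Mod = moduleAlgebra M

  evalP-cong : ∀ {n} (t : Poly Mod n) {u v : Fin n → X} → (∀ r → u r ≡ v r) → evalP Mod t u ≡ evalP Mod t v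
  evalP-cong (var (inj₁ r))    u≗v = u≗v r
  evalP-cong (var (inj₂ c))    u≗v = refl
  evalP-cong (op addM ts)      u≗v = cong₂ _+_ (evalP-cong (ts zero) u≗v) (evalP-cong (ts (suc zero)) u≗v)
  evalP-cong (op zeroM ts)     u≗v = refl
  evalP-cong (op negM ts)      u≗v = cong -_ (evalP-cong (ts zero) u≗v)
  evalP-cong (op (scalM r) ts) u≗v = cong (r *ₗ_) (evalP-cong (ts zero) u≗v)

  evalP-d : ∀ {n} (t : Poly Mod n) (u v w : Fin n → X) →
            evalP Mod t (λ r → d (u r) (v r) (w r)) ≡ d (evalP Mod t u) (evalP Mod t v) (evalP Mod t w)
  evalP-d (var (inj₁ r))    u v w = refl
  evalP-d (var (inj₂ c))    u v w = sym (d-cancelʳ c c)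
  evalP-d (op addM ts)      u v w = trans (cong₂ _+_ (evalP-d (ts zero) u v w) (evalP-d (ts (suc zero)) u v w)) (+-d _ _ _ _ _ _)
  evalP-d (op zeroM ts)     u v w = sym (d-cancelʳ 0ᴹ 0ᴹ)
  evalP-d (op negM ts)      u v w = trans (cong -_ (evalP-d (ts zero) u v w)) (-‿d _ _ _)
  evalP-d (op (scalM r) ts) u v w = trans (cong (r *ₗ_) (evalP-d (ts zero) u v w)) (*ₗ-d r _ _ _)

coord-injective : ∀ {k} {L : Fin k → Set} {s t : Prod k L} → (∀ i → coord s i ≡ coord t i) → s ≡ t
coord-injective {zero}  _     = refl
coord-injective {suc k} s≗t = cong₂ _,_ (s≗t zero) (coord-injective (s≗t ∘ suc))

coord-tabulateP : ∀ {k} {L : Fin k → Set} (z : (i : Fin k) → L i) i → coord (tabulateP z) i ≡ z i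
coord-tabulateP z zero    = refl
coord-tabulateP z (suc i) = coord-tabulateP (z ∘ suc) i

AgreeAbove : ∀ {k} {L : Fin k → Set} → Fin k → Prod k L → Prod k L → Set
AgreeAbove i s t = ∀ j → toℕ i < toℕ j → coord s j ≡ coord t j

agreeAbove-tail : ∀ {k} {L : Fin (suc k) → Set} {i} {a b : L zero} {t t′ : Prod k (L ∘ suc)} →
                  t ≡ t′ → AgreeAbove {L = L} i (a , t) (b , t′)
agreeAbove-tail refl zero    ()
agreeAbove-tail refl (suc j) _ = refl

agreeAbove-suc : ∀ {k} {L : Fin (suc k) → Set} {a : L zero} {i} {t t′ : Prod k (L ∘ suc)} →
                 AgreeAbove i t t′ → AgreeAbove {L = L} (suc i) (a , t) (a , t′)
agreeAbove-suc t~t′ zero    ()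
agreeAbove-suc t~t′ (suc j) (s≤s i<j) = t~t′ j i<j

record Triangular {k} {L : Fin k → Set} (U : Prod k L → Prod k L) : Set where
  field
    layer       : (i : Fin k) → Prod k L → L i → L i
    layer-local : ∀ i {s t} → AgreeAbove i s t → ∀ a → layer i s a ≡ layer i t a
    coord-U     : ∀ i s → coord (U s) i ≡ layer i s (coord s i)

module _ {k} {L : Fin (suc k) → Set} {U : Prod (suc k) L → Prod (suc k) L} (T : Triangular {L = L} U) where
  open Triangular T

  tailMap : L zero → Prod k (L ∘ suc) → Prod k (L ∘ suc)
  tailMap a t = proj₂ (U (a , t))

  tailMap-triangular : ∀ a → Triangular (tailMap a)
  tailMap-triangular a = record
    { layer       = λ i t → layer (suc i) (a , t)
    ; layer-local = λ i t~t′ → layer-local (suc i) (agreeAbove-suc {L = L} t~t′)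
    ; coord-U     = λ i t → coord-U (suc i) (a , t)
    }

  tailMap-head-irrelevant : ∀ a b t → tailMap a t ≡ tailMap b t
  tailMap-head-irrelevant a b t = coord-injective {L = L ∘ suc} λ i → begin
    coord (tailMap a t) i             ≡⟨ coord-U (suc i) (a , t) ⟩
    layer (suc i) (a , t) (coord t i) ≡⟨ layer-local (suc i) (agreeAbove-tail {L = L} refl) (coord t i) ⟩
    layer (suc i) (b , t) (coord t i) ≡⟨ coord-U (suc i) (b , t) ⟨
    coord (tailMap b t) i             ∎

triangular-injective : ∀ {k} {L : Fin k → Set} {U : Prod k L → Prod k L} (T : Triangular U) →
                       (∀ i s → Injective _≡_ _≡_ (Triangular.layer T i s)) → Injective _≡_ _≡_ U
triangular-injective {zero}          T inj {_}     {_}       _      = refl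
triangular-injective {suc k} {L} {U} T inj {a , t} {a′ , t′} Us≡Us′ = cong₂ _,_ a≡a′ t≡t′
  where
  open Triangular T
  t≡t′ : t ≡ t′
  t≡t′ = triangular-injective (tailMap-triangular T a) (λ i t → inj (suc i) (a , t)) (begin
    tailMap T a t    ≡⟨ cong proj₂ Us≡Us′ ⟩
    tailMap T a′ t′  ≡⟨ tailMap-head-irrelevant T a′ a t′ ⟩
    tailMap T a t′   ∎)
  a≡a′ : a ≡ a′
  a≡a′ = inj zero (a , t) (begin
    layer zero (a , t) a      ≡⟨ coord-U zero (a , t) ⟨
    proj₁ (U (a , t))         ≡⟨ cong proj₁ Us≡Us′ ⟩
    proj₁ (U (a′ , t′))       ≡⟨ coord-U zero (a′ , t′) ⟩
    layer zero (a′ , t′) a′   ≡⟨ layer-local zero (agreeAbove-tail {L = L} (sym t≡t′)) a′ ⟩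
    layer zero (a , t) a′     ∎)

triangular-strictlySurjective : ∀ {k} {L : Fin k → Set} {U : Prod k L → Prod k L} (T : Triangular U) →
                                (∀ i s → StrictlySurjective _≡_ (Triangular.layer T i s)) →
                                StrictlySurjective _≡_ U
triangular-strictlySurjective {zero}          T surj _        = _ , refl
triangular-strictlySurjective {suc k} {L} {U} T surj (b , t′) = (a , t) , cong₂ _,_ head≡b tail≡t′
  where
  open Triangular T
  tailPreimage = triangular-strictlySurjective (tailMap-triangular T b) (λ i t → surj (suc i) (b , t)) t′
  t = proj₁ tailPreimage
  a = proj₁ (surj zero (b , t) b)
  head≡b : proj₁ (U (a , t)) ≡ b
  head≡b = begin
    proj₁ (U (a , t))     ≡⟨ coord-U zero (a , t) ⟩
    layer zero (a , t) a  ≡⟨ layer-local zero (agreeAbove-tail {L = L} refl) a ⟩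
    layer zero (b , t) a  ≡⟨ proj₂ (surj zero (b , t) b) ⟩
    b                     ∎
  tail≡t′ : tailMap T a t ≡ t′
  tail≡t′ = trans (tailMap-head-irrelevant T a b t) (proj₂ tailPreimage)

conjugate-bijective : ∀ {A B : Set} (φ : A ↔ B) {f : A → A} →
                      let f′ = Inverse.to φ ∘ f ∘ Inverse.from φ in
                      Injective _≡_ _≡_ f′ → StrictlySurjective _≡_ f′ → Bijective _≡_ _≡_ f
conjugate-bijective φ {f} f′-injective f′-surjective =
  f-injective , strictlySurjective⇒surjective f-surjective
  where
  open Inverse φ
  to∘f≡f′∘to : ∀ x → to (f x) ≡ to (f (from (to x)))
  to∘f≡f′∘to x = cong (to ∘ f) (sym (strictlyInverseʳ x))
  f-injective : Injective _≡_ _≡_ f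
  f-injective {x} {y} fx≡fy = begin
    x               ≡⟨ strictlyInverseʳ x ⟨
    from (to x)     ≡⟨ cong from (f′-injective (trans (sym (to∘f≡f′∘to x)) (trans (cong to fx≡fy) (to∘f≡f′∘to y)))) ⟩
    from (to y)     ≡⟨ strictlyInverseʳ y ⟩
    y               ∎
  f-surjective : StrictlySurjective _≡_ f
  f-surjective y with f′-surjective (to y)
  ... | s , f′s≡ty = from s , (begin
    f (from s)             ≡⟨ strictlyInverseʳ _ ⟨
    from (to (f (from s))) ≡⟨ cong from f′s≡ty ⟩
    from (to y)            ≡⟨ strictlyInverseʳ y ⟩
    y                      ∎)

triple : {X : Set} → X → X → X → Fin 3 → X
triple x y z zero             = x
triple x y z (suc zero)       = y
triple x y z (suc (suc zero)) = z

triple-map : {X Y : Set} (f : X → Y) (x y z : X) → ∀ r → f (triple x y z r) ≡ triple (f x) (f y) (f z) r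
triple-map f x y z zero             = refl
triple-map f x y z (suc zero)       = refl
triple-map f x y z (suc (suc zero)) = refl

module WreathRepProperties {S : Signature} {A : Algebra S} {k : ℕ} (W : WreathRep A k) where
  open WreathRep W

  modl : (i : Fin k) → ModuleOn (Univ i)
  modl i = AffineStructure.modl (affine i)

  open Inverse φ using (to; from; strictlyInverseˡ; strictlyInverseʳ)

  AnnihilatedBy : ℕ → Set
  AnnihilatedBy p = ∀ i a → mulM (modl i) p a ≡ ModuleOn.0ᴹ (modl i)

  π-injective : ∀ {x y} → (∀ j → π x j ≡ π y j) → x ≡ y
  π-injective {x} {y} πx≗πy = begin
    x               ≡⟨ strictlyInverseʳ x ⟨
    from (to x)     ≡⟨ cong from (coord-injective πx≗πy) ⟩
    from (to y)     ≡⟨ strictlyInverseʳ y ⟩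
    y               ∎

  π-from : ∀ s j → π (from s) j ≡ coord s j
  π-from s j = cong (λ t → coord t j) (strictlyInverseˡ s)

  π-zeroA : ∀ i → π zeroA i ≡ ModuleOn.0ᴹ (modl i)
  π-zeroA i = trans (π-from _ i) (coord-tabulateP _ i)

  private
    opTermIsOp : ∀ i f → IsPolyOp (moduleAlgebra (modl i)) (arity S f) (⟦ L i ⟧ f)
    opTermIsOp i f = proj₁ (AffineStructure.polyEq (affine i) _ (⟦ L i ⟧ f)) (op f (var ∘ inj₁) , λ _ → refl)

  opTerm : ∀ i f → Poly (moduleAlgebra (modl i)) (arity S f)
  opTerm i f = proj₁ (opTermIsOp i f)

  evalP-opTerm : ∀ i f u → evalP (moduleAlgebra (modl i)) (opTerm i f) u ≡ ⟦ L i ⟧ f u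
  evalP-opTerm i f = proj₂ (opTermIsOp i f)

  -- There is no function extensionality, so congruence of ⟦ L i ⟧ f comes from its module term.
  opᴸ-cong : ∀ i f {u v} → (∀ r → u r ≡ v r) → ⟦ L i ⟧ f u ≡ ⟦ L i ⟧ f v
  opᴸ-cong i f {u} {v} u≗v = begin
    ⟦ L i ⟧ f u                                     ≡⟨ evalP-opTerm i f u ⟨
    evalP (moduleAlgebra (modl i)) (opTerm i f) u   ≡⟨ ModuleOnProperties.evalP-cong (modl i) (opTerm i f) u≗v ⟩
    evalP (moduleAlgebra (modl i)) (opTerm i f) v   ≡⟨ evalP-opTerm i f v ⟩
    ⟦ L i ⟧ f v                                     ∎

  eval-preserves-α : ∀ n {V : Set} (t : Term S V) {ρ ρ′ : V → Carrier A} →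
                     (∀ v → α n (ρ v) (ρ′ v)) → α n (eval A ρ t) (eval A ρ′ t)
  eval-preserves-α n (var v)   ρ~ρ′ = ρ~ρ′ v
  eval-preserves-α n (op f ts) {ρ} {ρ′} ρ~ρ′ j n≤j = begin
    π (⟦ A ⟧ f xs) j                          ≡⟨ proj₂ (proj₂ (wreath j f)) xs ⟩
    ⟦ L j ⟧ f (λ r → π (xs r) j) +ᵢ fhat xs   ≡⟨ cong₂ _+ᵢ_ (opᴸ-cong j f λ r → eval-preserves-α n (ts r) ρ~ρ′ j n≤j)
                                                            (proj₁ (proj₂ (wreath j f)) xs ys λ r j′ j<j′ →
                                                              eval-preserves-α n (ts r) ρ~ρ′ j′ (≤-trans n≤j (<⇒≤ j<j′))) ⟩
    ⟦ L j ⟧ f (λ r → π (ys r) j) +ᵢ fhat ys   ≡⟨ proj₂ (proj₂ (wreath j f)) ys ⟨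
    π (⟦ A ⟧ f ys) j                          ∎
    where
    xs = λ r → eval A ρ (ts r)
    ys = λ r → eval A ρ′ (ts r)
    fhat = proj₁ (wreath j f)

  evalP-preserves-α : ∀ n {m} (t : Poly A m) {xs ys : Fin m → Carrier A} →
                      (∀ r → α n (xs r) (ys r)) → α n (evalP A t xs) (evalP A t ys)
  evalP-preserves-α n t xs~ys = eval-preserves-α n t λ { (inj₁ r) → xs~ys r ; (inj₂ c) _ _ → refl }

  evalP-cong : ∀ {n} (t : Poly A n) {xs ys : Fin n → Carrier A} → (∀ r → xs r ≡ ys r) → evalP A t xs ≡ evalP A t ys
  evalP-cong t xs≗ys = π-injective λ j → evalP-preserves-α 0 t (λ r j _ → cong (λ x → π x j) (xs≗ys r)) j z≤n

  module _ (i : Fin k) where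
    private
      module Mᵢ = ModuleOnProperties (modl i)
      Modᵢ = moduleAlgebra (modl i)
    open Mᵢ using (_+_; -_; 0ᴹ; d; assoc; identityʳ)

    record Splitting {n : ℕ} (t : Poly A n) : Set where
      field
        affinePart      : (Fin n → Univ i) → Univ i
        affinePart-cong : ∀ {u v} → (∀ r → u r ≡ v r) → affinePart u ≡ affinePart v
        affinePart-d    : ∀ u v w → affinePart (λ r → d (u r) (v r) (w r)) ≡
                                    d (affinePart u) (affinePart v) (affinePart w)
        carry           : (Fin n → Carrier A) → Univ i
        carry-local     : ∀ {xs ys} → (∀ r → α (suc (toℕ i)) (xs r) (ys r)) → carry xs ≡ carry ys
        π-evalP         : ∀ xs → π (evalP A t xs) i ≡ affinePart (λ r → π (xs r) i) + carry xs

    splitting : ∀ {n} (t : Poly A n) → Splitting t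
    splitting (var (inj₁ r)) = record
      { affinePart = λ a → a r ; affinePart-cong = λ u≗v → u≗v r ; affinePart-d = λ _ _ _ → refl
      ; carry = λ _ → 0ᴹ ; carry-local = λ _ → refl ; π-evalP = λ _ → sym (identityʳ _) }
    splitting (var (inj₂ c)) = record
      { affinePart = λ _ → π c i ; affinePart-cong = λ _ → refl ; affinePart-d = λ _ _ _ → sym (Mᵢ.d-cancelʳ _ _)
      ; carry = λ _ → 0ᴹ ; carry-local = λ _ → refl ; π-evalP = λ _ → sym (identityʳ _) }
    splitting {n} (op f ts) = record
      { affinePart      = affinePart
      ; affinePart-cong = λ u≗v → Mᵢ.evalP-cong (opTerm i f) λ j → Sub.affinePart-cong j u≗v
      ; affinePart-d    = λ u v w → trans (Mᵢ.evalP-cong (opTerm i f) λ j → Sub.affinePart-d j u v w)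
                                          (Mᵢ.evalP-d (opTerm i f) _ _ _)
      ; carry           = carry
      ; carry-local     = λ xs~ys → cong₂ _+_
          (cong (- T (λ _ → 0ᴹ) +_) (Mᵢ.evalP-cong (opTerm i f) λ j → Sub.carry-local j xs~ys))
          (proj₁ (proj₂ (wreath i f)) _ _ λ r → evalP-preserves-α (suc (toℕ i)) (ts r) xs~ys)
      ; π-evalP         = π-evalP
      }
      where
      module Sub j = Splitting (splitting (ts j))
      T = evalP Modᵢ (opTerm i f)
      affinePart : (Fin n → Univ i) → Univ i
      affinePart a = T (λ j → Sub.affinePart j a)
      carry : (Fin n → Carrier A) → Univ i
      carry xs = - T (λ _ → 0ᴹ) + T (λ j → Sub.carry j xs) + proj₁ (wreath i f) (λ j → evalP A (ts j) xs)
      π-evalP : ∀ xs → π (evalP A (op f ts) xs) i ≡ affinePart (λ r → π (xs r) i) + carry xs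
      π-evalP xs = begin
        π (evalP A (op f ts) xs) i                          ≡⟨ proj₂ (proj₂ (wreath i f)) _ ⟩
        ⟦ L i ⟧ f (λ j → π (evalP A (ts j) xs) i) + fhat     ≡⟨ cong (_+ fhat) (evalP-opTerm i f _) ⟨
        T (λ j → π (evalP A (ts j) xs) i) + fhat             ≡⟨ cong (_+ fhat) (Mᵢ.evalP-cong (opTerm i f) λ j →
                                                                  trans (Sub.π-evalP j xs) (sym (Mᵢ.d-zero _ _))) ⟩
        T (λ j → d (Aⱼ j) 0ᴹ (Cⱼ j)) + fhat                  ≡⟨ cong (_+ fhat) (Mᵢ.evalP-d (opTerm i f) Aⱼ _ Cⱼ) ⟩
        T Aⱼ + - T (λ _ → 0ᴹ) + T Cⱼ + fhat                  ≡⟨ assoc _ _ fhat ⟩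
        T Aⱼ + - T (λ _ → 0ᴹ) + (T Cⱼ + fhat)                ≡⟨ assoc _ _ _ ⟩
        T Aⱼ + (- T (λ _ → 0ᴹ) + (T Cⱼ + fhat))              ≡⟨ cong (T Aⱼ +_) (sym (assoc _ _ _)) ⟩
        affinePart (λ r → π (xs r) i) + carry xs             ∎
        where
        fhat = proj₁ (wreath i f) (λ j → evalP A (ts j) xs)
        Aⱼ = λ j → Sub.affinePart j (λ r → π (xs r) i)
        Cⱼ = λ j → Sub.carry j xs

  module MaltsevAddition (m : Poly A 3) (mal : IsMaltsev A m) where

    infixl 6 _⊞_
    _⊞_ : Carrier A → Carrier A → Carrier A
    _⊞_ = plusVia A m zeroA

    ⊞-evalP : ∀ x y → x ⊞ y ≡ evalP A m (triple x zeroA y)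
    ⊞-evalP x y = evalP-cong m λ { zero → refl ; (suc zero) → refl ; (suc (suc zero)) → refl }

    m-x00 : ∀ x → evalP A m (triple x zeroA zeroA) ≡ x
    m-x00 x = trans (evalP-cong m λ { zero → refl ; (suc zero) → refl ; (suc (suc zero)) → refl })
                    (proj₁ (mal zeroA x))

    m-00y : ∀ y → evalP A m (triple zeroA zeroA y) ≡ y
    m-00y y = trans (evalP-cong m λ { zero → refl ; (suc zero) → refl ; (suc (suc zero)) → refl })
                    (proj₂ (mal zeroA y))

    ⊞-preserves-α : ∀ n {x x′ y y′} → α n x x′ → α n y y′ → α n (x ⊞ y) (x′ ⊞ y′)
    ⊞-preserves-α n x~x′ y~y′ =
      evalP-preserves-α n m λ { zero → x~x′ ; (suc zero) → λ _ _ → refl ; (suc (suc zero)) → y~y′ }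

    mulL-preserves-α : ∀ n q {x y} → α n x y → α n (mulL _⊞_ q x) (mulL _⊞_ q y)
    mulL-preserves-α n zero          x~y = x~y
    mulL-preserves-α n (suc zero)    x~y = x~y
    mulL-preserves-α n (suc (suc q)) x~y = ⊞-preserves-α n (mulL-preserves-α n (suc q) x~y) x~y

    mulL-zeroA : ∀ q → mulL _⊞_ q zeroA ≡ zeroA
    mulL-zeroA zero          = refl
    mulL-zeroA (suc zero)    = refl
    mulL-zeroA (suc (suc q)) = begin
      mulL _⊞_ (suc q) zeroA ⊞ zeroA   ≡⟨ cong (_⊞ zeroA) (mulL-zeroA (suc q)) ⟩
      zeroA ⊞ zeroA                    ≡⟨ ⊞-evalP zeroA zeroA ⟩
      evalP A m (triple zeroA zeroA zeroA) ≡⟨ m-00y zeroA ⟩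
      zeroA                            ∎

    module _ (i : Fin k) where
      open ModuleOnProperties (modl i)
        using (_+_; -_; 0ᴹ; _·_; d; d-cancelʳ; d-cancelˡ; d-zero; +-d; ·-zeroʳ; x≈z//y
              ; assoc; comm; interchange; identityˡ; identityʳ)
      open Splitting (splitting i m)

      private
        zᵢ = π zeroA i
        G : Univ i → Univ i → Univ i → Univ i
        G a b c = affinePart (triple a b c)
        h : Carrier A → Carrier A → Carrier A → Univ i
        h x y w = carry (triple x y w)

        π-m : ∀ x y w → π (evalP A m (triple x y w)) i ≡ G (π x i) (π y i) (π w i) + h x y w
        π-m x y w = trans (π-evalP _) (cong (_+ h x y w) (affinePart-cong (triple-map (λ x → π x i) x y w)))

        G-x00 : ∀ x → G (π x i) zᵢ zᵢ ≡ π x i + - h x zeroA zeroA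
        G-x00 x = x≈z//y _ _ _ (trans (sym (π-m x zeroA zeroA)) (cong (λ x → π x i) (m-x00 x)))

        G-00y : ∀ y → G zᵢ zᵢ (π y i) ≡ π y i + - h zeroA zeroA y
        G-00y y = x≈z//y _ _ _ (trans (sym (π-m zeroA zeroA y)) (cong (λ x → π x i) (m-00y y)))

        G-x0y : ∀ a b → G a zᵢ b ≡ d (G a zᵢ zᵢ) (G zᵢ zᵢ zᵢ) (G zᵢ zᵢ b)
        G-x0y a b = trans (affinePart-cong λ { zero → sym (d-cancelʳ a zᵢ) ; (suc zero) → sym (d-cancelʳ zᵢ zᵢ)
                                              ; (suc (suc zero)) → sym (d-cancelˡ zᵢ b) })
                          (affinePart-d _ _ _)

      ⊞-carry : Carrier A → Carrier A → Univ i
      ⊞-carry x y = d (- h x zeroA zeroA) (- h zeroA zeroA zeroA) (- h zeroA zeroA y) + h x zeroA y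

      π-⊞ : ∀ x y → π (x ⊞ y) i ≡ π x i + π y i + ⊞-carry x y
      π-⊞ x y = begin
        π (x ⊞ y) i                                      ≡⟨ cong (λ x → π x i) (⊞-evalP x y) ⟩
        π (evalP A m (triple x zeroA y)) i               ≡⟨ π-m x zeroA y ⟩
        G (π x i) zᵢ (π y i) + h x zeroA y               ≡⟨ cong (_+ h x zeroA y) (G-x0y _ _) ⟩
        d (G (π x i) zᵢ zᵢ) (G zᵢ zᵢ zᵢ) (G zᵢ zᵢ (π y i)) + h x zeroA y
          ≡⟨ cong (_+ h x zeroA y) (cong₂ (λ a b → d a b (G zᵢ zᵢ (π y i))) (G-x00 x) (G-x00 zeroA)) ⟩
        d (π x i + - h x zeroA zeroA) (zᵢ + - h zeroA zeroA zeroA) (G zᵢ zᵢ (π y i)) + h x zeroA y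
          ≡⟨ cong (λ c → d _ _ c + h x zeroA y) (G-00y y) ⟩
        d (π x i + - h x zeroA zeroA) (zᵢ + - h zeroA zeroA zeroA) (π y i + - h zeroA zeroA y) + h x zeroA y
          ≡⟨ cong (_+ h x zeroA y) (+-d _ _ _ _ _ _) ⟨
        d (π x i) zᵢ (π y i) + dh + h x zeroA y          ≡⟨ cong (λ c → d (π x i) c (π y i) + dh + h x zeroA y) (π-zeroA i) ⟩
        d (π x i) 0ᴹ (π y i) + dh + h x zeroA y          ≡⟨ cong (λ c → c + dh + h x zeroA y) (d-zero _ _) ⟩
        π x i + π y i + dh + h x zeroA y                 ≡⟨ assoc _ _ _ ⟩
        π x i + π y i + ⊞-carry x y                      ∎
        where
        dh = d (- h x zeroA zeroA) (- h zeroA zeroA zeroA) (- h zeroA zeroA y)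

      ⊞-carry-local : ∀ {x x′ y y′} → α (suc (toℕ i)) x x′ → α (suc (toℕ i)) y y′ → ⊞-carry x y ≡ ⊞-carry x′ y′
      ⊞-carry-local x~x′ y~y′ = cong₂ _+_
        (cong₂ (λ a b → d (- a) _ (- b)) (carry-local (local₃ x~x′ refl′ refl′)) (carry-local (local₃ refl′ refl′ y~y′)))
        (carry-local (local₃ x~x′ refl′ y~y′))
        where
        refl′ : α (suc (toℕ i)) zeroA zeroA
        refl′ _ _ = refl
        local₃ : ∀ {x x′ y y′ w w′} → α (suc (toℕ i)) x x′ → α (suc (toℕ i)) y y′ → α (suc (toℕ i)) w w′ →
                 ∀ r → α (suc (toℕ i)) (triple x y w r) (triple x′ y′ w′ r)
        local₃ x~x′ y~y′ w~w′ zero             = x~x′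
        local₃ x~x′ y~y′ w~w′ (suc zero)       = y~y′
        local₃ x~x′ y~y′ w~w′ (suc (suc zero)) = w~w′

      mulL-carry : ∀ q .{{_ : NonZero q}} → Carrier A → Univ i
      mulL-carry (suc zero)    x = 0ᴹ
      mulL-carry (suc (suc q)) x = mulL-carry (suc q) x + ⊞-carry (mulL _⊞_ (suc q) x) x

      mulL-layer : ∀ q .{{_ : NonZero q}} → Carrier A → Univ i → Univ i
      mulL-layer q x a = q · a + mulL-carry q x

      π-mulL : ∀ q .{{_ : NonZero q}} x → π (mulL _⊞_ q x) i ≡ mulL-layer q x (π x i)
      π-mulL (suc zero)    x = sym (trans (identityʳ _) (identityʳ _))
      π-mulL (suc (suc q)) x = begin
        π (mulL _⊞_ (suc q) x ⊞ x) i                       ≡⟨ π-⊞ _ x ⟩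
        π (mulL _⊞_ (suc q) x) i + π x i + E               ≡⟨ cong (λ c → c + π x i + E) (π-mulL (suc q) x) ⟩
        suc q · π x i + C + π x i + E                      ≡⟨ assoc _ (π x i) E ⟩
        suc q · π x i + C + (π x i + E)                    ≡⟨ interchange _ C (π x i) E ⟩
        suc q · π x i + π x i + (C + E)                    ≡⟨ cong (_+ (C + E)) (comm _ (π x i)) ⟩
        mulL-layer (suc (suc q)) x (π x i)                 ∎
        where
        C = mulL-carry (suc q) x
        E = ⊞-carry (mulL _⊞_ (suc q) x) x

      mulL-carry-local : ∀ q .{{_ : NonZero q}} {x y} → α (suc (toℕ i)) x y → mulL-carry q x ≡ mulL-carry q y
      mulL-carry-local (suc zero)    x~y = refl
      mulL-carry-local (suc (suc q)) x~y =
        cong₂ _+_ (mulL-carry-local (suc q) x~y) (⊞-carry-local (mulL-preserves-α _ (suc q) x~y) x~y)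

      mulL-carry-zeroA : ∀ q .{{_ : NonZero q}} → mulL-carry q zeroA ≡ 0ᴹ
      mulL-carry-zeroA q = begin
        mulL-carry q zeroA                   ≡⟨ identityˡ _ ⟨
        0ᴹ + mulL-carry q zeroA              ≡⟨ cong (_+ mulL-carry q zeroA) (trans (cong (q ·_) (π-zeroA i)) (·-zeroʳ q)) ⟨
        q · π zeroA i + mulL-carry q zeroA   ≡⟨ π-mulL q zeroA ⟨
        π (mulL _⊞_ q zeroA) i               ≡⟨ cong (λ x → π x i) (mulL-zeroA q) ⟩
        π zeroA i                            ≡⟨ π-zeroA i ⟩
        0ᴹ                                   ∎

      mulL-layer-local : ∀ q .{{_ : NonZero q}} {x y} → α (suc (toℕ i)) x y → ∀ a → mulL-layer q x a ≡ mulL-layer q y a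
      mulL-layer-local q x~y a = cong (q · a +_) (mulL-carry-local q x~y)

      π-mulL-≡0 : ∀ {p} .{{_ : NonZero p}} → (∀ a → p · a ≡ 0ᴹ) → ∀ {x} → α (suc (toℕ i)) x zeroA →
                  π (mulL _⊞_ p x) i ≡ 0ᴹ
      π-mulL-≡0 {p} p·≡0 {x} x~0 = begin
        π (mulL _⊞_ p x) i          ≡⟨ π-mulL p x ⟩
        p · π x i + mulL-carry p x  ≡⟨ cong (_+ mulL-carry p x) (p·≡0 (π x i)) ⟩
        0ᴹ + mulL-carry p x         ≡⟨ identityˡ _ ⟩
        mulL-carry p x              ≡⟨ mulL-carry-local p x~0 ⟩
        mulL-carry p zeroA          ≡⟨ mulL-carry-zeroA p ⟩
        0ᴹ                          ∎

    uPow-agrees-with-zeroA : ∀ p .{{_ : NonZero p}} → AnnihilatedBy p →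
                             ∀ l x j → k ≤ toℕ j ℕ.+ l → π (uPow _⊞_ p l x) j ≡ π zeroA j
    uPow-agrees-with-zeroA p p·≡0 zero    x j k≤j+0 = ⊥-elim (<⇒≱ (toℕ<n j) (subst (k ≤_) (+-identityʳ _) k≤j+0))
    uPow-agrees-with-zeroA p p·≡0 (suc l) x j k≤j+1+l =
      trans (π-mulL-≡0 j (p·≡0 j) λ j′ j<j′ →
               uPow-agrees-with-zeroA p p·≡0 l x j′ (≤-trans (subst (k ≤_) (+-suc _ l) k≤j+1+l) (+-monoˡ-≤ l j<j′)))
            (sym (π-zeroA j))

    uPow-vanishes : ∀ p .{{_ : NonZero p}} → AnnihilatedBy p → ∀ l → k ≤ l → ∀ x → uPow _⊞_ p l x ≡ zeroA
    uPow-vanishes p p·≡0 l k≤l x = π-injective λ j → uPow-agrees-with-zeroA p p·≡0 l x j (≤-trans k≤l (m≤n+m l (toℕ j)))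

    mulL-triangular : ∀ q .{{_ : NonZero q}} → Triangular (to ∘ mulL _⊞_ q ∘ from)
    mulL-triangular q = record
      { layer       = λ i s → mulL-layer i q (from s)
      ; layer-local = λ i {s} {t} s~t → mulL-layer-local i q λ j i<j →
                        trans (π-from s j) (trans (s~t j i<j) (sym (π-from t j)))
      ; coord-U     = λ i s → trans (π-mulL i q (from s)) (cong (mulL-layer i q (from s)) (π-from s i))
      }

    mulL-bijective : ∀ {p} q .{{_ : NonZero q}} → AnnihilatedBy p → Coprime q p → Bijective _≡_ _≡_ (mulL _⊞_ q)
    mulL-bijective q p·≡0 q⊥p = conjugate-bijective φ
      (triangular-injective (mulL-triangular q) λ i s → ModuleOnProperties.·+-injective (modl i) (p·≡0 i) q⊥p _)
      (triangular-strictlySurjective (mulL-triangular q) λ i s →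
         ModuleOnProperties.·+-strictlySurjective (modl i) (p·≡0 i) q⊥p _)

    uPow-bijective : ∀ {p} q .{{_ : NonZero q}} → AnnihilatedBy p → Coprime q p →
                     ∀ l → Bijective _≡_ _≡_ (uPow _⊞_ q l)
    uPow-bijective q p·≡0 q⊥p zero    = Identity.bijective _≡_
    uPow-bijective q p·≡0 q⊥p (suc l) =
      Composition.bijective _≡_ _≡_ _≡_ (uPow-bijective q p·≡0 q⊥p l) (mulL-bijective q p·≡0 q⊥p)

distinct-primes-coprime : ∀ {p q} → Prime q → Prime p → q ≢ p → Coprime q p
distinct-primes-coprime {p} {q} q-prime p-prime q≢p with <-cmp q p
... | tri< q<p _ _ = Coprimality.sym (prime⇒coprime p-prime {{prime⇒nonZero q-prime}} q<p)
... | tri≈ _ q≡p _ = ⊥-elim (q≢p q≡p)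
... | tri> _ _ p<q = prime⇒coprime q-prime {{prime⇒nonZero p-prime}} p<q

lemma5p4 : ∀ {S : Signature} (A : Algebra S) (k : ℕ) (W : WreathRep A k)
    (p : ℕ) → Prime p →
    ((i : Fin k) → HasExponent (AffineStructure.modl (WreathRep.affine W i)) p) →
    Nilpotent A →
    (m : Poly A 3) → IsMaltsev A m →
    let _+_ = plusVia A m (WreathRep.zeroA W)
    in (∀ (q : ℕ) → Prime q → q ≢ p → ∀ (l : ℕ) → 1 ≤ l → Bijective _≡_ _≡_ (uPow _+_ q l))
       × (∀ (l : ℕ) → k ≤ l → ∀ x → uPow _+_ p l x ≡ WreathRep.zeroA W)
lemma5p4 A k W p p-prime exp-p _ m mal = uPow-q-bijective , uPow-vanishes p p·≡0
  where
  open WreathRepProperties W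
  open MaltsevAddition m mal
  instance _ = prime⇒nonZero p-prime
  p·≡0 : AnnihilatedBy p
  p·≡0 i = proj₁ (proj₂ (exp-p i))
  uPow-q-bijective : ∀ q → Prime q → q ≢ p → ∀ l → 1 ≤ l → Bijective _≡_ _≡_ (uPow _⊞_ q l)
  uPow-q-bijective q q-prime q≢p l _ =
    uPow-bijective q {{prime⇒nonZero q-prime}} p·≡0 (distinct-primes-coprime q-prime p-prime q≢p) l
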